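{- Let $G$ be a finite graph with $\gamma(G)=2$. Then $\gamma_{\rm MB}(G)=\gamma(G)=2$ if and only if $G$ has a vertex that lies in at least two $\gamma$-sets of $G$.
   Context: All graphs are finite and simple. $\gamma(G)$ is the domination number; a $\gamma$-set is a dominating set of size $\gamma(G)$. The Maker-Breaker domination game on $G$: Dominator and Staller alternately select a vertex not selected before; Dominator wins if at some point his selected vertices form a dominating set of $G$, Staller wins otherwise. In the D-game Dominator moves first. $\gamma_{\rm MB}(G)$ is the minimum $k$ such that Dominator has a strategy in the D-game guaranteeing that his selected vertices dominate $G$ after at most $k$ of his moves, whatever Staller does ($\infty$ if he has no winning strategy). -}

module Defs where

open import Data.Nat using (ℕ; zero; suc; _≤_; _<_)
open import Data.Fin using (Fin)
open import Data.Fin.Subset using (Subset; _∈_; _∉_; _∪_; ⁅_⁆; ∣_∣) renaming (⊥ to ∅)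
open import Data.Product using (Σ; _×_; ∃)
open import Data.Sum using (_⊎_)
open import Data.Empty using (⊥)
open import Relation.Nullary using (¬_)
open import Relation.Binary.PropositionalEquality using (_≡_)

record SimpleGraph (n : ℕ) : Set₁ where
  field
    Adj     : Fin n → Fin n → Set
    sym     : ∀ {u v} → Adj u v → Adj v u
    irrefl  : ∀ {v} → ¬ Adj v v

open SimpleGraph public

module _ {n : ℕ} (G : SimpleGraph n) where

  Dominates : Subset n → Set
  Dominates D = ∀ v → v ∈ D ⊎ Σ (Fin n) (λ u → u ∈ D × Adj G u v)

  IsDominationNumber : ℕ → Set
  IsDominationNumber k =
    Σ (Subset n) (λ D → Dominates D × ∣ D ∣ ≡ k)
    × (∀ D → Dominates D → k ≤ ∣ D ∣)

  IsGammaSet : Subset n → Set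
  IsGammaSet D = Dominates D × (∀ D' → Dominates D' → ∣ D ∣ ≤ ∣ D' ∣)

  Free : Subset n → Subset n → Fin n → Set
  Free D S v = v ∉ D × v ∉ S

  -- DomWins k D S: in the position where
  -- Dominator has selected D, Staller has selected S, and it is Dominator's
  -- turn, Dominator can guarantee that his selected vertices dominate G
  -- after at most k further moves of his.  The game ends (Dominator losing)
  -- when a player to move has no unselected vertex available.
  DomWins : ℕ → Subset n → Subset n → Set
  DomWins zero    D S = Dominates D
  DomWins (suc k) D S =
    Dominates D ⊎
    Σ (Fin n) (λ v → Free D S v ×
      (Dominates (⁅ v ⁆ ∪ D) ⊎
        (Σ (Fin n) (λ w → Free (⁅ v ⁆ ∪ D) S w)
         × (∀ w → Free (⁅ v ⁆ ∪ D) S w → DomWins k (⁅ v ⁆ ∪ D) (⁅ w ⁆ ∪ S)))))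

  DomWinsDGameWithin : ℕ → Set
  DomWinsDGameWithin k = DomWins k ∅ ∅

  IsMBDominationNumber : ℕ → Set
  IsMBDominationNumber k =
    DomWinsDGameWithin k × (∀ j → j < k → ¬ DomWinsDGameWithin j)

-- With γ(G) = 2, a γ-set through a vertex v is a pair {a, v}.  If v lies in two
-- γ-sets {a, v} and {b, v}, Dominator opens with v and answers Staller by
-- whichever of a, b is still free.  Conversely, if Dominator wins in two
-- moves from the opening v, he has a dominating reply x₁ to some Staller move;
-- had Staller taken x₁ instead, he would need another reply x₂ ≠ x₁, so
-- {x₁, v} and {x₂, v} are two γ-sets through v.  Fewer than two moves never
-- suffice since no single vertex dominates G.
module Submission where

open import Defs hiding (sym)
open import Data.Fin using (Fin)
open import Data.Fin.Properties using (_≟_; any?)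
open import Data.Fin.Subset
  using (Subset; _∈_; _∉_; _∪_; _-_; _⊆_; ⁅_⁆; ∣_∣) renaming (⊥ to ∅)
open import Data.Fin.Subset.Properties
open import Data.Nat using (ℕ; zero; suc; _+_; _≤_; _<_; z≤n; s≤s)
open import Data.Nat.Properties
  using (≤-trans; ≤-reflexive; ≤-<-trans; +-suc; +-mono-≤; n≤1+n; +-monoʳ-≤; <⇒≱)
open import Data.Vec using (_∷_; [])
open import Data.Bool using (true; false)
open import Data.Product using (Σ; ∃-syntax; _×_; _,_; proj₁; proj₂)
open import Data.Sum using (_⊎_; inj₁; inj₂)
open import Data.Empty using (⊥-elim)
open import Function.Bundles using (_⇔_; mk⇔)
open import Relation.Nullary using (¬_; yes; no; contradiction; ¬?; _×-dec_)
open import Relation.Binary.PropositionalEquality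
  using (_≡_; _≢_; refl; sym; trans; cong; subst; ≢-sym)

private variable
  n : ℕ
  p : Subset n
  v x y z : Fin n

x∈p⇒0<∣p∣ : x ∈ p → 0 < ∣ p ∣
x∈p⇒0<∣p∣ x∈p = ≤-<-trans z≤n (x∈p⇒∣p-x∣<∣p∣ x∈p)

k<∣p-x∣⇒1+k<∣p∣ : ∀ {k} → k < ∣ p - x ∣ → x ∈ p → suc k < ∣ p ∣
k<∣p-x∣⇒1+k<∣p∣ k<∣p-x∣ x∈p = ≤-trans (s≤s k<∣p-x∣) (x∈p⇒∣p-x∣<∣p∣ x∈p)

distinct³⇒2<∣p∣ : x ∈ p → y ∈ p → z ∈ p → x ≢ y → x ≢ z → y ≢ z → 2 < ∣ p ∣
distinct³⇒2<∣p∣ {x = x} {p = p} {y = y} {z = z} x∈p y∈p z∈p x≢y x≢z y≢z =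
  k<∣p-x∣⇒1+k<∣p∣ (k<∣p-x∣⇒1+k<∣p∣ (x∈p⇒0<∣p∣ z∈p-x-y) y∈p-x) x∈p
  where
  y∈p-x : y ∈ p - x
  y∈p-x = x∈p∧x≢y⇒x∈p-y y∈p (≢-sym x≢y)
  z∈p-x-y : z ∈ p - x - y
  z∈p-x-y = x∈p∧x≢y⇒x∈p-y (x∈p∧x≢y⇒x∈p-y z∈p (≢-sym x≢z)) (≢-sym y≢z)

∣p∪q∣≤∣p∣+∣q∣ : ∀ (p q : Subset n) → ∣ p ∪ q ∣ ≤ ∣ p ∣ + ∣ q ∣
∣p∪q∣≤∣p∣+∣q∣ []          []          = z≤n
∣p∪q∣≤∣p∣+∣q∣ (true ∷ p)  (true ∷ q)  =
  s≤s (≤-trans (∣p∪q∣≤∣p∣+∣q∣ p q) (+-monoʳ-≤ ∣ p ∣ (n≤1+n ∣ q ∣)))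
∣p∪q∣≤∣p∣+∣q∣ (true ∷ p)  (false ∷ q) = s≤s (∣p∪q∣≤∣p∣+∣q∣ p q)
∣p∪q∣≤∣p∣+∣q∣ (false ∷ p) (true ∷ q)  =
  ≤-trans (s≤s (∣p∪q∣≤∣p∣+∣q∣ p q)) (≤-reflexive (sym (+-suc ∣ p ∣ ∣ q ∣)))
∣p∪q∣≤∣p∣+∣q∣ (false ∷ p) (false ∷ q) = ∣p∪q∣≤∣p∣+∣q∣ p q

1<∣p∣⇒∃-member-≢ : ∀ v (p : Subset n) → 1 < ∣ p ∣ → ∃[ a ] (a ∈ p × a ≢ v)
1<∣p∣⇒∃-member-≢ v p 1<∣p∣ with any? (λ a → a ∈? p ×-dec ¬? (a ≟ v))
... | yes found = found
... | no none =
  contradiction (≤-trans (p⊆q⇒∣p∣≤∣q∣ p⊆⁅v⁆) (≤-reflexive (∣⁅x⁆∣≡1 v))) (<⇒≱ 1<∣p∣)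
  where
  p⊆⁅v⁆ : p ⊆ ⁅ v ⁆
  p⊆⁅v⁆ {a} a∈p with a ≟ v
  ... | yes refl = x∈⁅x⁆ v
  ... | no a≢v = ⊥-elim (none (a , a∈p , a≢v))

-- Dominator's selection after his first, resp. second, move, in the exact
-- shape produced by DomWins.
single : Fin n → Subset n
single v = ⁅ v ⁆ ∪ ∅

pair : Fin n → Fin n → Subset n
pair x v = ⁅ x ⁆ ∪ single v

∣single∣≡1 : ∀ (v : Fin n) → ∣ single v ∣ ≡ 1
∣single∣≡1 v = trans (cong ∣_∣ (∪-identityʳ ⁅ v ⁆)) (∣⁅x⁆∣≡1 v)

∈single⇒≡ : y ∈ single v → y ≡ v
∈single⇒≡ {v = v} y∈ = x∈⁅y⁆⇒x≡y v (subst (_ ∈_) (∪-identityʳ ⁅ v ⁆) y∈)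

≢⇒∉single : y ≢ v → y ∉ single v
≢⇒∉single y≢v y∈ = y≢v (∈single⇒≡ y∈)

∉single⇒≢ : y ∉ single v → y ≢ v
∉single⇒≢ {v = v} y∉ refl = y∉ (p⊆p∪q ∅ (x∈⁅x⁆ v))

x∈pair : ∀ (x v : Fin n) → x ∈ pair x v
x∈pair x v = p⊆p∪q (single v) (x∈⁅x⁆ x)

v∈pair : ∀ (x v : Fin n) → v ∈ pair x v
v∈pair x v = q⊆p∪q ⁅ x ⁆ (single v) (p⊆p∪q ∅ (x∈⁅x⁆ v))

∈pair⁻ : y ∈ pair x v → y ≡ x ⊎ y ≡ v
∈pair⁻ {x = x} {v} y∈ with x∈p∪q⁻ ⁅ x ⁆ (single v) y∈
... | inj₁ y∈⁅x⁆ = inj₁ (x∈⁅y⁆⇒x≡y x y∈⁅x⁆)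
... | inj₂ y∈single = inj₂ (∈single⇒≡ y∈single)

∣pair∣≤2 : ∀ (x v : Fin n) → ∣ pair x v ∣ ≤ 2
∣pair∣≤2 x v = ≤-trans (∣p∪q∣≤∣p∣+∣q∣ ⁅ x ⁆ (single v))
  (+-mono-≤ (≤-reflexive (∣⁅x⁆∣≡1 x)) (≤-reflexive (∣single∣≡1 v)))

pair⊆ : x ∈ p → v ∈ p → pair x v ⊆ p
pair⊆ x∈p v∈p y∈ with ∈pair⁻ y∈
... | inj₁ refl = x∈p
... | inj₂ refl = v∈p

VertexInTwoGammaSets : {n : ℕ} → SimpleGraph n → Set
VertexInTwoGammaSets {n} G = Σ (Fin n) (λ v → Σ (Subset n) (λ S → Σ (Subset n) (λ T →
  IsGammaSet G S × IsGammaSet G T × S ≢ T × v ∈ S × v ∈ T)))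

two-dominating-pairs⇒DomWins₂ : ∀ {a b} (G : SimpleGraph n) → a ≢ b → a ≢ v → b ≢ v →
  Dominates G (pair a v) → Dominates G (pair b v) → DomWinsDGameWithin G 2
two-dominating-pairs⇒DomWins₂ {v = v} {a} {b} G a≢b a≢v b≢v dom-a dom-b =
  inj₂ (v , (∉⊥ , ∉⊥) , inj₂ ((a , ≢⇒∉single a≢v , ∉⊥) , reply))
  where
  reply : ∀ w → Free G (single v) ∅ w → DomWins G 1 (single v) (single w)
  reply w _ with w ≟ a
  ... | yes refl = inj₂ (b , (≢⇒∉single b≢v , ≢⇒∉single (≢-sym a≢b)) , inj₁ dom-b)
  ... | no w≢a = inj₂ (a , (≢⇒∉single a≢v , ≢⇒∉single (≢-sym w≢a)) , inj₁ dom-a)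

module DominationNumberTwo {n : ℕ} (G : SimpleGraph n) (γ≡2 : IsDominationNumber G 2) where

  2≤∣dominating∣ : ∀ D → Dominates G D → 2 ≤ ∣ D ∣
  2≤∣dominating∣ = proj₂ γ≡2

  ¬Dominates-∅ : ¬ Dominates G ∅
  ¬Dominates-∅ dom with subst (2 ≤_) (∣⊥∣≡0 n) (2≤∣dominating∣ ∅ dom)
  ... | ()

  ¬Dominates-single : ∀ v → ¬ Dominates G (single v)
  ¬Dominates-single v dom = <⇒≱ (2≤∣dominating∣ (single v) dom) (≤-reflexive (∣single∣≡1 v))

  Dominates-pair⇒IsGammaSet : ∀ x v → Dominates G (pair x v) → IsGammaSet G (pair x v)
  Dominates-pair⇒IsGammaSet x v dom =
    dom , λ D dom-D → ≤-trans (∣pair∣≤2 x v) (2≤∣dominating∣ D dom-D)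

  IsGammaSet∋v⇒≡pair : ∀ {S v} → IsGammaSet G S → v ∈ S → ∃[ a ] (a ≢ v × S ≡ pair a v)
  IsGammaSet∋v⇒≡pair {S} {v} (dom-S , minimal-S) v∈S
    with 1<∣p∣⇒∃-member-≢ v S (2≤∣dominating∣ S dom-S)
  ... | a , a∈S , a≢v = a , a≢v , ⊆-antisym S⊆pair (pair⊆ a∈S v∈S)
    where
    ∣S∣≤2 : ∣ S ∣ ≤ 2
    ∣S∣≤2 = let (D , dom-D , ∣D∣≡2) = proj₁ γ≡2 in
      subst (∣ S ∣ ≤_) ∣D∣≡2 (minimal-S D dom-D)
    S⊆pair : S ⊆ pair a v
    S⊆pair {y} y∈S with y ≟ v | y ≟ a
    ... | yes refl | _        = v∈pair a v
    ... | no _     | yes refl = x∈pair a v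
    ... | no y≢v   | no y≢a   =
      contradiction ∣S∣≤2
        (<⇒≱ (distinct³⇒2<∣p∣ v∈S a∈S y∈S (≢-sym a≢v) (≢-sym y≢v) (≢-sym y≢a)))

  ¬DomWins<2 : ∀ j → j < 2 → ¬ DomWinsDGameWithin G j
  ¬DomWins<2 zero          _ dom = ¬Dominates-∅ dom
  ¬DomWins<2 (suc zero)    _ (inj₁ dom) = ¬Dominates-∅ dom
  ¬DomWins<2 (suc zero)    _ (inj₂ (v , _ , inj₁ dom)) = ¬Dominates-single v dom
  ¬DomWins<2 (suc zero)    _ (inj₂ (v , _ , inj₂ ((w , free) , wins))) =
    ¬Dominates-single v (wins w free)
  ¬DomWins<2 (suc (suc j)) (s≤s (s≤s ()))

  completing-reply : ∀ {v S} → DomWins G 1 (single v) S →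
    ∃[ x ] (x ≢ v × x ∉ S × Dominates G (pair x v))
  completing-reply {v} (inj₁ dom) = ⊥-elim (¬Dominates-single v dom)
  completing-reply (inj₂ (x , (x∉ , x∉S) , inj₁ dom)) = x , ∉single⇒≢ x∉ , x∉S , dom
  completing-reply (inj₂ (x , (x∉ , x∉S) , inj₂ ((w , free) , wins))) =
    x , ∉single⇒≢ x∉ , x∉S , wins w free

  DomWins₂⇒VertexInTwoGammaSets : DomWinsDGameWithin G 2 → VertexInTwoGammaSets G
  DomWins₂⇒VertexInTwoGammaSets (inj₁ dom) = ⊥-elim (¬Dominates-∅ dom)
  DomWins₂⇒VertexInTwoGammaSets (inj₂ (v , _ , inj₁ dom)) = ⊥-elim (¬Dominates-single v dom)
  DomWins₂⇒VertexInTwoGammaSets (inj₂ (v , _ , inj₂ ((w , free) , wins)))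
    with completing-reply (wins w free)
  ... | x₁ , x₁≢v , _ , dom₁ with completing-reply (wins x₁ (≢⇒∉single x₁≢v , ∉⊥))
  ... | x₂ , _ , x₂∉single-x₁ , dom₂ =
    v , pair x₁ v , pair x₂ v ,
    Dominates-pair⇒IsGammaSet x₁ v dom₁ , Dominates-pair⇒IsGammaSet x₂ v dom₂ ,
    pairs-differ , v∈pair x₁ v , v∈pair x₂ v
    where
    pairs-differ : pair x₁ v ≢ pair x₂ v
    pairs-differ eq with ∈pair⁻ (subst (x₁ ∈_) eq (x∈pair x₁ v))
    ... | inj₁ x₁≡x₂ = ∉single⇒≢ x₂∉single-x₁ (sym x₁≡x₂)
    ... | inj₂ x₁≡v = x₁≢v x₁≡v

  VertexInTwoGammaSets⇒DomWins₂ : VertexInTwoGammaSets G → DomWinsDGameWithin G 2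
  VertexInTwoGammaSets⇒DomWins₂ (v , S , T , γ-S , γ-T , S≢T , v∈S , v∈T)
    with IsGammaSet∋v⇒≡pair γ-S v∈S | IsGammaSet∋v⇒≡pair γ-T v∈T
  ... | a , a≢v , refl | b , b≢v , refl =
    two-dominating-pairs⇒DomWins₂ G a≢b a≢v b≢v (proj₁ γ-S) (proj₁ γ-T)
    where
    a≢b : a ≢ b
    a≢b refl = S≢T refl

proposition3p2 : ∀ {n} (G : SimpleGraph n) → IsDominationNumber G 2 →
    (IsMBDominationNumber G 2 ⇔
      Σ (Fin n) (λ v → Σ (Subset n) (λ S → Σ (Subset n) (λ T →
        IsGammaSet G S × IsGammaSet G T × S ≢ T × v ∈ S × v ∈ T))))
proposition3p2 G γ≡2 = mk⇔
  (λ (wins , _) → DomWins₂⇒VertexInTwoGammaSets wins)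
  (λ shared → VertexInTwoGammaSets⇒DomWins₂ shared , ¬DomWins<2)
  where open DominationNumberTwo G γ≡2
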